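{- For $i\in\{1,3\}$, let $C_{i,j}$ be the number of codewords of Hamming weight $j$ in $C_i$. Then $C_{i,j}=C_{i,N_i-j}$ for all $j$ with $0\le j\le N_i$.
   Context: $q=2^r$ (with $q\ge4$ for $i=1$), $\mathbb{F}_q$ the field with $q$ elements, $tr$ the trace $\mathbb{F}_q\to\mathbb{F}_2$. Fix $b\in\mathbb{F}_q$ with $tr(b)=1$ and an ordering $\gamma_0=0,\gamma_1,\ldots,\gamma_{q/2-1}$ of $\{\beta\in\mathbb{F}_q:tr\beta=0\}$. Put $N_1=q-2$, $N_3=q$, $v_1=(\gamma_1^{ -1},\ldots,\gamma_{q/2-1}^{ -1},\gamma_1^{ -1},\ldots,\gamma_{q/2-1}^{ -1})\in\mathbb{F}_q^{N_1}$, $v_3=((b+\gamma_0)^{ -1},\ldots,(b+\gamma_{q/2-1})^{ -1},(b+\gamma_0)^{ -1},\ldots,(b+\gamma_{q/2-1})^{ -1})\in\mathbb{F}_q^{N_3}$, and $C_i=\{u\in\mathbb{F}_2^{N_i}:\sum_k u_k(v_i)_k=0\text{ in }\mathbb{F}_q\}$. -}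

module Defs where

open import Level using (_⊔_)
open import Algebra.Bundles using (CommutativeRing)
open import Data.Nat using (ℕ; zero; suc; _∸_; _^_; _<_; _<ᵇ_; _≡ᵇ_)
open import Data.Fin using (Fin)
open import Data.Bool using (Bool; true; false; if_then_else_)
open import Data.Vec using (Vec; []; _∷_)
open import Data.List using (List; []; _∷_; _++_; map; length; filterᵇ)
open import Data.Product using (∃-syntax; _×_)
open import Relation.Nullary using (¬_; does)
open import Relation.Binary using (Decidable)
open import Relation.Binary.PropositionalEquality using (_≡_)

record IsFiniteField {c ℓ} (R : CommutativeRing c ℓ) (q : ℕ) : Set (c ⊔ ℓ) where
  open CommutativeRing R
  field
    _⁻¹      : Carrier → Carrier
    0≉1      : ¬ (0# ≈ 1#)
    inverseʳ : ∀ x → ¬ (x ≈ 0#) → (x * (x ⁻¹)) ≈ 1#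
    _≟_      : Decidable _≈_
    enum     : Fin q → Carrier
    enum-injective  : ∀ i j → enum i ≈ enum j → i ≡ j
    enum-surjective : ∀ x → ∃[ i ] enum i ≈ x

allWords : (n : ℕ) → List (Vec Bool n)
allWords zero = [] ∷ []
allWords (suc n) = map (false ∷_) (allWords n) ++ map (true ∷_) (allWords n)

weight : ∀ {n} → Vec Bool n → ℕ
weight [] = 0
weight (false ∷ u) = weight u
weight (true ∷ u) = suc (weight u)

module _ {c ℓ} (R : CommutativeRing c ℓ) {q : ℕ} (F : IsFiniteField R q) where
  open CommutativeRing R
  open IsFiniteField F

  pow : Carrier → ℕ → Carrier
  pow x zero = 1#
  pow x (suc n) = x * pow x n

  sumTo : ℕ → (ℕ → Carrier) → Carrier
  sumTo zero f = 0#
  sumTo (suc n) f = sumTo n f + f n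

  -- absolute trace F_{2^r} → F_2 : tr x = Σ_{k<r} x^(2^k), valued in {0#,1#}
  trace : (r : ℕ) → Carrier → Carrier
  trace r x = sumTo r (λ k → pow x (2 ^ k))

  -- γ : ℕ → Carrier, restricted to indices < h, is an ordering
  -- γ_0 = 0, γ_1, …, γ_{h-1} of the trace-zero elements (h = q/2).
  IsTraceZeroOrdering : (r h : ℕ) → (ℕ → Carrier) → Set (c ⊔ ℓ)
  IsTraceZeroOrdering r h γ =
      (γ 0 ≈ 0#)
    × (∀ i → i < h → trace r (γ i) ≈ 0#)
    × (∀ i j → i < h → j < h → γ i ≈ γ j → i ≡ j)
    × (∀ β → trace r β ≈ 0# → ∃[ i ] (i < h × γ i ≈ β))

  -- Σ_k u_k v_k for a binary word u (entries read in F_2 ⊆ F_q), v indexed from k₀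
  dotFrom : ∀ {n} → ℕ → (ℕ → Carrier) → Vec Bool n → Carrier
  dotFrom k v [] = 0#
  dotFrom k v (x ∷ u) = (if x then v k else 0#) + dotFrom (suc k) v u

  -- C = {u ∈ F_2^N : Σ_k u_k v_k = 0}; number of codewords of weight j
  weightCount : (N : ℕ) → (ℕ → Carrier) → ℕ → ℕ
  weightCount N v j =
    length (filterᵇ (λ u → (weight u ≡ᵇ j) Data.Bool.∧ does (dotFrom 0 v u ≟ 0#)) (allWords N))

  -- v_1 = (γ_1^{-1},…,γ_{h-1}^{-1}, γ_1^{-1},…,γ_{h-1}^{-1}), length N_1 = q - 2 (0-indexed)
  v₁ : (h : ℕ) → (ℕ → Carrier) → ℕ → Carrier
  v₁ h γ k = if k <ᵇ (h ∸ 1) then γ (suc k) ⁻¹ else γ (suc (k ∸ (h ∸ 1))) ⁻¹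

  -- v_3 = ((b+γ_0)^{-1},…,(b+γ_{h-1})^{-1}, same again), length N_3 = q (0-indexed)
  v₃ : (h : ℕ) → Carrier → (ℕ → Carrier) → ℕ → Carrier
  v₃ h b γ k = if k <ᵇ h then (b + γ k) ⁻¹ else (b + γ (k ∸ h)) ⁻¹

module Submission where

-- Both codes C₁ and C₃ are defined by a check vector that consists of the
-- same block written twice.  The theorem follows from three general facts.
--
--  * A finite field of even order has characteristic 2.  Indeed, if
--    1 + 1 ≠ 0 then x ↦ -x is an involution of the field whose only fixed
--    point is 0, so the order is odd (an involution of Fin n with exactly
--    one fixed point forces n to be odd).
--  * In characteristic 2 the entries of a doubled check vector (w, w) sum
--    to Σw + Σw = 0, i.e. the all-ones word lies in the code.
--  * If the entries of a check vector v sum to 0, then complementing a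
--    binary word u changes u·v into (Σ v) - u·v = -(u·v), so complementation
--    is a bijection between codewords of weight j and of weight N - j.

open import Defs
open import Algebra.Bundles using (CommutativeRing)
open import Data.Nat using (ℕ; _∸_; _^_; _≤_)
open import Data.Product using (_×_)
open import Relation.Binary.PropositionalEquality using (_≡_)

open import Data.Nat using (zero; suc; _+_; _*_; _<_; _<?_; _<ᵇ_; _≡ᵇ_)
import Data.Nat.Properties as ℕP
open import Data.Fin using (Fin; zero; suc; toℕ)
open import Data.Fin.Properties using (toℕ-injective) renaming (_≟_ to _≟ᶠ_)
open import Data.Fin.Permutation using (permutation)
open import Data.Bool using (Bool; true; false; if_then_else_; not; _∧_; T)
open import Data.Vec using (Vec; []; _∷_)
open import Data.List using (List; []; _∷_; _++_; map; length; filterᵇ)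
open import Data.List.Properties using (length-++; filter-++; filter-≐)
open import Data.Product using (∃-syntax; _,_; proj₁; proj₂)
open import Data.Empty using (⊥-elim)
open import Function using (_∘_; _⇔_; mk⇔; Equivalence)
open import Relation.Nullary using (Dec; does; ¬_)
open import Relation.Nullary.Decidable using (yes; no; does-⇔; T?)
open import Relation.Binary.PropositionalEquality
  using (refl; sym; trans; cong; cong₂; subst; module ≡-Reasoning)
open import Algebra.Properties.CommutativeMonoid.Sum ℕP.+-0-commutativeMonoid
  using (sum; sum-permute; ∑-distrib-+; sum-cong-≗; sum-replicate-zero)

[_] : ∀ {p} {P : Set p} → Dec P → ℕ
[ d ] = if does d then 1 else 0

indicator-⇔ : ∀ {p q} {P : Set p} {Q : Set q} → P ⇔ Q → (p? : Dec P) (q? : Dec Q) → [ p? ] ≡ [ q? ]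
indicator-⇔ P⇔Q p? q? = cong (λ b → if b then 1 else 0) (does-⇔ P⇔Q p? q?)

sum-const-one : ∀ n → sum {n} (λ _ → 1) ≡ n
sum-const-one zero = refl
sum-const-one (suc n) = cong suc (sum-const-one n)

sum-point-indicator : ∀ {n} (i₀ : Fin n) → sum (λ i → [ i ≟ᶠ i₀ ]) ≡ 1
sum-point-indicator {suc n} zero = cong suc (sum-replicate-zero n)
sum-point-indicator {suc n} (suc i₀) = sum-point-indicator i₀

trichotomy-indicator : ∀ m n → [ m ℕP.≟ n ] + ([ m <? n ] + [ n <? m ]) ≡ 1
trichotomy-indicator zero zero = refl
trichotomy-indicator zero (suc n) = refl
trichotomy-indicator (suc m) zero = refl
trichotomy-indicator (suc m) (suc n) = trichotomy-indicator m n

-- An involution of Fin n with exactly one fixed point forces n to be odd: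
-- the other points split into 2-cycles {i, σ i}, each counted once by
-- its smaller element.
involution-unique-fixed-point⇒odd : ∀ n (σ : Fin n → Fin n) → (∀ i → σ (σ i) ≡ i)
  → (i₀ : Fin n) → (∀ i → σ i ≡ i ⇔ i ≡ i₀) → ∃[ k ] n ≡ suc (2 * k)
involution-unique-fixed-point⇒odd n σ σ-inv i₀ fixed = sum smaller , (begin
    n                                                    ≡⟨ sym (sum-const-one n) ⟩
    sum {n} (λ _ → 1)                                    ≡⟨ sum-cong-≗ (λ i → sym (classify i)) ⟩
    sum (λ i → [ i ≟ᶠ i₀ ] + (smaller i + smaller (σ i))) ≡⟨ ∑-distrib-+ (λ i → [ i ≟ᶠ i₀ ]) _ ⟩
    sum (λ i → [ i ≟ᶠ i₀ ]) + sum (λ i → smaller i + smaller (σ i))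
      ≡⟨ cong₂ _+_ (sum-point-indicator i₀) (∑-distrib-+ smaller (smaller ∘ σ)) ⟩
    suc (sum smaller + sum (smaller ∘ σ))
      ≡⟨ cong (λ s → suc (sum smaller + s)) (sym (sum-permute smaller (permutation σ σ σ-inv σ-inv))) ⟩
    suc (sum smaller + sum smaller)
      ≡⟨ cong (λ s → suc (sum smaller + s)) (sym (ℕP.+-identityʳ (sum smaller))) ⟩
    suc (2 * sum smaller) ∎)
  where
  open ≡-Reasoning
  smaller : Fin n → ℕ
  smaller i = [ toℕ i <? toℕ (σ i) ]
  fixed⇔ : ∀ i → i ≡ i₀ ⇔ toℕ i ≡ toℕ (σ i)
  fixed⇔ i = mk⇔ (λ i≡i₀ → cong toℕ (sym (Equivalence.from (fixed i) i≡i₀)))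
                 (λ e → Equivalence.to (fixed i) (sym (toℕ-injective e)))
  classify : ∀ i → [ i ≟ᶠ i₀ ] + (smaller i + smaller (σ i)) ≡ 1
  classify i = begin
    [ i ≟ᶠ i₀ ] + (smaller i + smaller (σ i))
      ≡⟨ cong₂ (λ e s → e + (smaller i + s)) (indicator-⇔ (fixed⇔ i) (i ≟ᶠ i₀) (toℕ i ℕP.≟ toℕ (σ i)))
               (cong (λ j → [ toℕ (σ i) <? toℕ j ]) (σ-inv i)) ⟩
    [ toℕ i ℕP.≟ toℕ (σ i) ] + ([ toℕ i <? toℕ (σ i) ] + [ toℕ (σ i) <? toℕ i ])
      ≡⟨ trichotomy-indicator (toℕ i) (toℕ (σ i)) ⟩
    1 ∎

module CharacteristicTwo {c ℓ} (R : CommutativeRing c ℓ) where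
  open CommutativeRing R renaming (_+_ to _⊕_; _*_ to _⊛_; refl to ≈-refl; sym to ≈-sym; trans to ≈-trans)
  open import Algebra.Properties.Ring ring using (-‿involutive; -0#≈0#)
  open import Relation.Binary.Reasoning.Setoid setoid

  double≈two⊛ : ∀ x → x ⊕ x ≈ (1# ⊕ 1#) ⊛ x
  double≈two⊛ x = ≈-sym (≈-trans (distribʳ x 1# 1#) (+-cong (*-identityˡ x) (*-identityˡ x)))

  char-two⇒double≈0 : 1# ⊕ 1# ≈ 0# → ∀ x → x ⊕ x ≈ 0#
  char-two⇒double≈0 char2 x = ≈-trans (double≈two⊛ x) (≈-trans (*-congʳ char2) (zeroˡ x))

  module _ {q} (F : IsFiniteField R q) where
    open IsFiniteField F using (_⁻¹; inverseʳ)

    cancel-nonzero : ∀ {a x} → ¬ (a ≈ 0#) → a ⊛ x ≈ 0# → x ≈ 0#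
    cancel-nonzero {a} {x} a≉0 ax≈0 = begin
      x                   ≈⟨ ≈-sym (*-identityˡ x) ⟩
      1# ⊛ x              ≈⟨ *-congʳ (≈-sym (≈-trans (*-comm (a ⁻¹) a) (inverseʳ a a≉0))) ⟩
      (a ⁻¹ ⊛ a) ⊛ x      ≈⟨ *-assoc (a ⁻¹) a x ⟩
      a ⁻¹ ⊛ (a ⊛ x)      ≈⟨ *-congˡ ax≈0 ⟩
      a ⁻¹ ⊛ 0#           ≈⟨ zeroʳ (a ⁻¹) ⟩
      0# ∎

    self-negative⇒zero : ¬ (1# ⊕ 1# ≈ 0#) → ∀ {x} → x ≈ - x → x ≈ 0#
    self-negative⇒zero 2≉0 {x} x≈-x = cancel-nonzero 2≉0
      (≈-trans (≈-sym (double≈two⊛ x)) (≈-trans (+-congʳ x≈-x) (-‿inverseˡ x)))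

  -- If 1 + 1 ≠ 0, negation is an involution of the field fixing only 0,
  -- which makes the order odd.
  even-order⇒char-two : ∀ {m} → IsFiniteField R (2 * m) → 1# ⊕ 1# ≈ 0#
  even-order⇒char-two {m} F with (1# ⊕ 1#) ≟ 0#
    where open IsFiniteField F using (_≟_)
  ... | yes char2 = char2
  ... | no 2≉0 = ⊥-elim (ℕP.even≢odd m (proj₁ odd) (proj₂ odd))
    where
    open IsFiniteField F using (enum; enum-injective; enum-surjective)
    neg : Fin (2 * m) → Fin (2 * m)
    neg i = proj₁ (enum-surjective (- enum i))
    enum-neg : ∀ i → enum (neg i) ≈ - enum i
    enum-neg i = proj₂ (enum-surjective (- enum i))
    neg-involutive : ∀ i → neg (neg i) ≡ i
    neg-involutive i = enum-injective _ _
      (≈-trans (enum-neg (neg i)) (≈-trans (-‿cong (enum-neg i)) (-‿involutive (enum i))))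
    zero-index : Fin (2 * m)
    zero-index = proj₁ (enum-surjective 0#)
    enum-zero : enum zero-index ≈ 0#
    enum-zero = proj₂ (enum-surjective 0#)
    fixed⇔zero : ∀ i → neg i ≡ i ⇔ i ≡ zero-index
    fixed⇔zero i = mk⇔
      (λ e → enum-injective _ _ (≈-trans (self-negative⇒zero F 2≉0
               (≈-trans (≈-sym (reflexive (cong enum e))) (enum-neg i))) (≈-sym enum-zero)))
      (λ { refl → enum-injective _ _
               (≈-trans (enum-neg zero-index) (≈-trans (-‿cong enum-zero) (≈-trans -0#≈0# (≈-sym enum-zero)))) })
    odd : ∃[ k ] 2 * m ≡ suc (2 * k)
    odd = involution-unique-fixed-point⇒odd (2 * m) neg neg-involutive zero-index fixed⇔zero

complement : ∀ {n} → Vec Bool n → Vec Bool n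
complement [] = []
complement (x ∷ u) = not x ∷ complement u

weight-complement : ∀ {n} (u : Vec Bool n) → weight (complement u) + weight u ≡ n
weight-complement [] = refl
weight-complement (false ∷ u) = cong suc (weight-complement u)
weight-complement (true ∷ u) = trans (ℕP.+-suc _ _) (cong suc (weight-complement u))

count : ∀ {a} {A : Set a} → (A → Bool) → List A → ℕ
count P xs = length (filterᵇ P xs)

count-cong : ∀ {a} {A : Set a} {P Q : A → Bool} → (∀ x → P x ≡ Q x) → ∀ xs → count P xs ≡ count Q xs
count-cong {P = P} {Q} P≗Q xs =
  cong length (filter-≐ (T? ∘ P) (T? ∘ Q) ((λ {x} → subst T (P≗Q x)) , λ {x} → subst T (sym (P≗Q x))) xs)

count-map : ∀ {a b} {A : Set a} {B : Set b} (P : A → Bool) (f : B → A) xs →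
  count P (map f xs) ≡ count (P ∘ f) xs
count-map P f [] = refl
count-map P f (x ∷ xs) with P (f x)
... | true = cong suc (count-map P f xs)
... | false = count-map P f xs

count-allWords-suc : ∀ n (P : Vec Bool (suc n) → Bool) →
  count P (allWords (suc n)) ≡ count (P ∘ (false ∷_)) (allWords n) + count (P ∘ (true ∷_)) (allWords n)
count-allWords-suc n P = begin
  length (filterᵇ P (map (false ∷_) W ++ map (true ∷_) W))
    ≡⟨ cong length (filter-++ _ (map (false ∷_) W) (map (true ∷_) W)) ⟩
  length (filterᵇ P (map (false ∷_) W) ++ filterᵇ P (map (true ∷_) W))
    ≡⟨ length-++ (filterᵇ P (map (false ∷_) W)) ⟩
  count P (map (false ∷_) W) + count P (map (true ∷_) W)
    ≡⟨ cong₂ _+_ (count-map P (false ∷_) W) (count-map P (true ∷_) W) ⟩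
  count (P ∘ (false ∷_)) W + count (P ∘ (true ∷_)) W ∎
  where
  open ≡-Reasoning
  W = allWords n

count-complement : ∀ n (P : Vec Bool n → Bool) →
  count P (allWords n) ≡ count (P ∘ complement) (allWords n)
count-complement zero P = count-cong {P = P} {P ∘ complement} (λ { [] → refl }) (allWords zero)
count-complement (suc n) P = begin
  count P (allWords (suc n))
    ≡⟨ count-allWords-suc n P ⟩
  count (P ∘ (false ∷_)) W + count (P ∘ (true ∷_)) W
    ≡⟨ cong₂ _+_ (count-complement n (P ∘ (false ∷_))) (count-complement n (P ∘ (true ∷_))) ⟩
  count (P ∘ (false ∷_) ∘ complement) W + count (P ∘ (true ∷_) ∘ complement) W
    ≡⟨ ℕP.+-comm (count (P ∘ (false ∷_) ∘ complement) W) _ ⟩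
  count (P ∘ complement ∘ (false ∷_)) W + count (P ∘ complement ∘ (true ∷_)) W
    ≡⟨ sym (count-allWords-suc n (P ∘ complement)) ⟩
  count (P ∘ complement) (allWords (suc n)) ∎
  where
  open ≡-Reasoning
  W = allWords n

complementary-weights : ∀ {a b N j} → a + b ≡ N → j ≤ N → a ≡ j ⇔ b ≡ N ∸ j
complementary-weights {a} {b} {N} {j} a+b≡N j≤N = mk⇔
  (λ { refl → trans (sym (ℕP.m+n∸m≡n a b)) (cong (_∸ a) a+b≡N) })
  (λ { refl → trans (sym (ℕP.m+n∸n≡m a b)) (trans (cong (_∸ b) a+b≡N) (ℕP.m∸[m∸n]≡n j≤N)) })

module WeightSymmetry {c ℓ} (R : CommutativeRing c ℓ) {q} (F : IsFiniteField R q) where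
  open CommutativeRing R
    renaming (_+_ to _⊕_; refl to ≈-refl; sym to ≈-sym; trans to ≈-trans)
  open IsFiniteField F using (_≟_)
  open import Algebra.Properties.CommutativeSemigroup +-commutativeSemigroup using (interchange)
  open import Relation.Binary.Reasoning.Setoid setoid

  sumTo-cong : ∀ n {f g : ℕ → Carrier} → (∀ m → f m ≈ g m) → sumTo R F n f ≈ sumTo R F n g
  sumTo-cong zero f≈g = ≈-refl
  sumTo-cong (suc n) f≈g = +-cong (sumTo-cong n f≈g) (f≈g n)

  sumTo-suc-first : ∀ n (f : ℕ → Carrier) → sumTo R F (suc n) f ≈ f 0 ⊕ sumTo R F n (f ∘ suc)
  sumTo-suc-first zero f = +-comm 0# (f 0)
  sumTo-suc-first (suc n) f = begin
    sumTo R F (suc n) f ⊕ f (suc n)              ≈⟨ +-congʳ (sumTo-suc-first n f) ⟩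
    (f 0 ⊕ sumTo R F n (f ∘ suc)) ⊕ f (suc n)    ≈⟨ +-assoc _ _ _ ⟩
    f 0 ⊕ sumTo R F (suc n) (f ∘ suc) ∎

  dot-complement : ∀ {n} k (v : ℕ → Carrier) (u : Vec Bool n) →
    dotFrom R F k v (complement u) ⊕ dotFrom R F k v u ≈ sumTo R F n (λ m → v (k + m))
  dot-complement k v [] = +-identityˡ 0#
  dot-complement {suc n} k v (x ∷ u) = begin
    (entry (not x) ⊕ dotFrom R F (suc k) v (complement u)) ⊕ (entry x ⊕ dotFrom R F (suc k) v u)
      ≈⟨ interchange _ _ _ _ ⟩
    (entry (not x) ⊕ entry x) ⊕ (dotFrom R F (suc k) v (complement u) ⊕ dotFrom R F (suc k) v u)
      ≈⟨ +-cong (one-entry x) (dot-complement (suc k) v u) ⟩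
    v k ⊕ sumTo R F n (λ m → v (suc k + m))
      ≈⟨ +-cong (reflexive (cong v (sym (ℕP.+-identityʳ k))))
                (sumTo-cong n (λ m → reflexive (cong v (sym (ℕP.+-suc k m))))) ⟩
    v (k + 0) ⊕ sumTo R F n (λ m → v (k + suc m))
      ≈⟨ ≈-sym (sumTo-suc-first n (λ m → v (k + m))) ⟩
    sumTo R F (suc n) (λ m → v (k + m)) ∎
    where
    entry : Bool → Carrier
    entry y = if y then v k else 0#
    one-entry : ∀ y → entry (not y) ⊕ entry y ≈ v k
    one-entry true = +-identityˡ (v k)
    one-entry false = +-identityʳ (v k)

  zero⇔zero : ∀ {a b} → a ⊕ b ≈ 0# → a ≈ 0# ⇔ b ≈ 0#
  zero⇔zero {a} {b} a+b≈0 = mk⇔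
    (λ a≈0 → ≈-trans (≈-sym (+-identityˡ b)) (≈-trans (+-congʳ (≈-sym a≈0)) a+b≈0))
    (λ b≈0 → ≈-trans (≈-sym (+-identityʳ a)) (≈-trans (+-congˡ (≈-sym b≈0)) a+b≈0))

  -- If the check vector sums to zero, complementation maps codewords of
  -- weight j bijectively onto codewords of weight N - j.
  weight-symmetric : ∀ N (v : ℕ → Carrier) → sumTo R F N v ≈ 0# →
    ∀ j → j ≤ N → weightCount R F N v j ≡ weightCount R F N v (N ∸ j)
  weight-symmetric N v Σv≈0 j j≤N =
    trans (count-complement N codeword-of-weight-j) (count-cong complement-criterion (allWords N))
    where
    codeword-of-weight-j : Vec Bool N → Bool
    codeword-of-weight-j u = (weight u ≡ᵇ j) ∧ does (dotFrom R F 0 v u ≟ 0#)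
    complement-criterion : ∀ u → codeword-of-weight-j (complement u)
                               ≡ ((weight u ≡ᵇ (N ∸ j)) ∧ does (dotFrom R F 0 v u ≟ 0#))
    complement-criterion u = cong₂ _∧_
      (does-⇔ (complementary-weights (weight-complement u) j≤N)
              (weight (complement u) ℕP.≟ j) (weight u ℕP.≟ (N ∸ j)))
      (does-⇔ (zero⇔zero (≈-trans (dot-complement 0 v u) Σv≈0))
              (dotFrom R F 0 v (complement u) ≟ 0#) (dotFrom R F 0 v u ≟ 0#))

doubled : ∀ {a} {A : Set a} → ℕ → (ℕ → A) → ℕ → A
doubled H w k = if k <ᵇ H then w k else w (k ∸ H)

if-true : ∀ {a} {A : Set a} {b : Bool} {x y : A} → T b → (if b then x else y) ≡ x
if-true {b = true} _ = refl

if-false : ∀ {a} {A : Set a} {b : Bool} {x y : A} → ¬ T b → (if b then x else y) ≡ y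
if-false {b = false} _ = refl
if-false {b = true} ¬t = ⊥-elim (¬t _)

module Doubled {c ℓ} (R : CommutativeRing c ℓ) {q} (F : IsFiniteField R q) where
  open CommutativeRing R
    renaming (_+_ to _⊕_; refl to ≈-refl; sym to ≈-sym; trans to ≈-trans)
  open import Relation.Binary.Reasoning.Setoid setoid
  open CharacteristicTwo R using (char-two⇒double≈0)
  open WeightSymmetry R F using (weight-symmetric)

  sumTo-first-copy : ∀ H w n → n ≤ H → sumTo R F n (doubled H w) ≈ sumTo R F n w
  sumTo-first-copy H w zero _ = ≈-refl
  sumTo-first-copy H w (suc n) n<H =
    +-cong (sumTo-first-copy H w n (ℕP.<⇒≤ n<H)) (reflexive (if-true (ℕP.<⇒<ᵇ n<H)))

  sumTo-doubled : ∀ H w n → sumTo R F (H + n) (doubled H w) ≈ sumTo R F H w ⊕ sumTo R F n w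
  sumTo-doubled H w zero rewrite ℕP.+-identityʳ H =
    ≈-trans (sumTo-first-copy H w H ℕP.≤-refl) (≈-sym (+-identityʳ _))
  sumTo-doubled H w (suc n) rewrite ℕP.+-suc H n = begin
    sumTo R F (H + n) (doubled H w) ⊕ doubled H w (H + n)
      ≈⟨ +-cong (sumTo-doubled H w n) (reflexive second-copy) ⟩
    (sumTo R F H w ⊕ sumTo R F n w) ⊕ w n
      ≈⟨ +-assoc _ _ _ ⟩
    sumTo R F H w ⊕ sumTo R F (suc n) w ∎
    where
    second-copy : doubled H w (H + n) ≡ w n
    second-copy = trans (if-false (λ t → ℕP.m+n≮m H n (ℕP.<ᵇ⇒< (H + n) H t)))
                        (cong w (ℕP.m+n∸m≡n H n))

  -- In characteristic 2 a doubled check vector sums to zero, so its code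
  -- has a symmetric weight distribution.
  doubled-weight-symmetric : 1# ⊕ 1# ≈ 0# → ∀ {N} H w → N ≡ H + H →
    ∀ j → j ≤ N → weightCount R F N (doubled H w) j ≡ weightCount R F N (doubled H w) (N ∸ j)
  doubled-weight-symmetric char2 H w refl = weight-symmetric (H + H) (doubled H w)
    (≈-trans (sumTo-doubled H w H) (char-two⇒double≈0 char2 _))

-- The lengths 2h = q and 2(h - 1) = q - 2 of the doubled vectors v₃ and v₁.
double≡sum : ∀ x → 2 * x ≡ x + x
double≡sum x = cong (x +_) (ℕP.+-identityʳ x)

double-minus-two : ∀ x → 0 < x → 2 * x ∸ 2 ≡ (x ∸ 1) + (x ∸ 1)
double-minus-two (suc x) _ = cong (_∸ 1) (trans (cong (x +_) (ℕP.+-identityʳ (suc x))) (ℕP.+-suc x x))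

-- For r = 0 the trace is the empty sum 0, contradicting tr b = 1.  For
-- r = 1 + r' the field has characteristic 2, and v₁, v₃ are the doubled
-- vectors of (γ_k⁻¹)_{1 ≤ k < h} and ((b + γ_k)⁻¹)_{k < h}, with
-- h = 2^r' = q/2, of lengths 2(h - 1) = q - 2 and 2h = q.
corollary8 : ∀ {c ℓ} (R : CommutativeRing c ℓ) (r : ℕ) (F : IsFiniteField R (2 ^ r))
    (b : CommutativeRing.Carrier R)
    → CommutativeRing._≈_ R (trace R F r b) (CommutativeRing.1# R)
    → (γ : ℕ → CommutativeRing.Carrier R)
    → IsTraceZeroOrdering R F r (2 ^ (r ∸ 1)) γ
    → ((2 ≤ r) → ∀ j → j ≤ 2 ^ r ∸ 2
         → weightCount R F (2 ^ r ∸ 2) (v₁ R F (2 ^ (r ∸ 1)) γ) j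
           ≡ weightCount R F (2 ^ r ∸ 2) (v₁ R F (2 ^ (r ∸ 1)) γ) (2 ^ r ∸ 2 ∸ j))
      × (∀ j → j ≤ 2 ^ r
         → weightCount R F (2 ^ r) (v₃ R F (2 ^ (r ∸ 1)) b γ) j
           ≡ weightCount R F (2 ^ r) (v₃ R F (2 ^ (r ∸ 1)) b γ) (2 ^ r ∸ j))
corollary8 R zero F _ tr-b≈1 _ _ = (λ ()) , ⊥-elim (IsFiniteField.0≉1 F tr-b≈1)
corollary8 R (suc r') F b _ γ _ =
    (λ _ → doubled-weight-symmetric char2 (h ∸ 1) (λ k → γ (suc k) ⁻¹) (double-minus-two h (ℕP.m^n>0 2 r')))
  , doubled-weight-symmetric char2 h (λ k → (b ⊕ γ k) ⁻¹) (double≡sum h)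
  where
  open CommutativeRing R using (_≈_; 0#; 1#) renaming (_+_ to _⊕_)
  open IsFiniteField F using (_⁻¹)
  open Doubled R F using (doubled-weight-symmetric)
  h : ℕ
  h = 2 ^ r'
  char2 : 1# ⊕ 1# ≈ 0#
  char2 = CharacteristicTwo.even-order⇒char-two R {h} F
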